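{- Let $e\geq 2$ and $l\geq 1$ be integers, let $\mathbf{s}=(s_1,\ldots,s_l)\in\mathbb{Z}^l$ and let $\boldsymbol{\lambda}=(\lambda^1,\ldots,\lambda^l)$ be an $l$-partition. If $\boldsymbol{\lambda}$ is a reduced $(e,\mathbf{s})$-core, then $\mathbf{s}\in\overline{\mathcal{A}}^l_e$.
   Context: A partition is a nonincreasing sequence $\lambda=(\lambda_1\geq\lambda_2\geq\cdots)$ of nonnegative integers, with finitely many nonzero terms; an $l$-partition is an $l$-tuple of partitions. For a partition $\lambda$ and an integer $s$, the abacus of $\lambda$ with charge $s$ is the subset $L_s(\lambda)=\{\lambda_j-j+s : j\geq 1\}\subset\mathbb{Z}$. For subsets $L,L'\subset\mathbb{Z}$ write $L\subset L'$ for inclusion. An $l$-partition $\boldsymbol{\lambda}=(\lambda^1,\ldots,\lambda^l)$ is a reduced $(e,\mathbf{s})$-core if either $l=1$ and $L_{s_1}(\lambda^1)\subset L_{s_1+e}(\lambda^1)$, or $l>1$ and $L_{s_1}(\lambda^1)\subset L_{s_2}(\lambda^2)\subset\cdots\subset L_{s_l}(\lambda^l)\subset L_{s_1+e}(\lambda^1)$. Define $\overline{\mathcal{A}}^l_e=\{(s_1,\ldots,s_l)\in\mathbb{Z}^l : 0\leq s_j-s_i\leq e \text{ for all } 1\leq i<j\leq l\}$. -}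

module Defs where

open import Data.Nat as ℕ using (ℕ; zero; suc)
open import Data.Integer as ℤ using (ℤ; +_; _+_; _-_; _≤_)
open import Data.List using (List; []; _∷_)
open import Data.Fin using (Fin; zero; suc; _<_; toℕ; fromℕ<)
open import Data.Product using (Σ; ∃; _×_; _,_)
open import Data.Empty using (⊥)
import Data.Fin
open import Relation.Binary.PropositionalEquality using (_≡_)

-- A partition: a finite list of parts (the sequence is padded by zeros),
-- required to be nonincreasing.
data Nonincreasing : List ℕ → Set where
  []  : Nonincreasing []
  [-] : ∀ {a} → Nonincreasing (a ∷ [])
  _∷_ : ∀ {a b xs} → b ℕ.≤ a → Nonincreasing (b ∷ xs) → Nonincreasing (a ∷ b ∷ xs)

record Partition : Set where
  constructor mkPartition
  field
    parts      : List ℕ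
    nonincr    : Nonincreasing parts

-- λ_j for j ≥ 1 (indexing: part j = λ_{j+1}); zero beyond the list.
part : List ℕ → ℕ → ℕ
part []       _       = 0
part (x ∷ xs) zero    = x
part (x ∷ xs) (suc j) = part xs j

_∈L[_,_] : ℤ → ℤ → Partition → Set
x ∈L[ s , p ] = Σ ℕ λ j → x ≡ (+ part (Partition.parts p) j) - (+ suc j) + s

_,_⊆L_,_ : ℤ → Partition → ℤ → Partition → Set
s , p ⊆L t , q = ∀ x → x ∈L[ s , p ] → x ∈L[ t , q ]

-- An l-partition is Fin l → Partition; a charge is Fin l → ℤ (index i ↦ component i+1).
-- Reduced (e,s)-core.
ReducedCore : (e : ℕ) (l : ℕ) → (Fin l → ℤ) → (Fin l → Partition) → Set
ReducedCore e zero    s P = ⊥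
ReducedCore e (suc zero) s P = s zero , P zero ⊆L (s zero + + e) , P zero
ReducedCore e (suc (suc l)) s P =
  ((i : Fin (suc l)) → s (Data.Fin.inject₁ i) , P (Data.Fin.inject₁ i) ⊆L s (suc i) , P (suc i))
  × (s (Data.Fin.fromℕ (suc l)) , P (Data.Fin.fromℕ (suc l)) ⊆L (s zero + + e) , P zero)

InClosedAlcove : (e l : ℕ) → (Fin l → ℤ) → Set
InClosedAlcove e l s = ∀ (i j : Fin l) → i < j → (+ 0 ≤ s j - s i) × (s j - s i ≤ + e)

module Submission where

-- The whole argument rests on one fact about abaci:
--   if L_s(λ) ⊆ L_t(μ) then s ≤ t.
-- Write b_j = λ_j - j + s (j ≥ 1) for the beads of L_s(λ).  They strictly
-- decrease in j, so the inclusion sends the j-th bead of L_s(λ) to the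
-- k(j)-th bead of L_t(μ) for a strictly increasing k, whence j ≤ k(j).
-- Far out (j beyond both partitions) all parts vanish, so the equality
-- s - j = t - k(j) of the matched beads gives t - s = k(j) - j ≥ 0.
--
-- For a reduced core the inclusions L_{s_1} ⊆ L_{s_2} ⊆ … ⊆ L_{s_l} ⊆ L_{s_1+e}
-- therefore give s_1 ≤ s_2 ≤ … ≤ s_l ≤ s_1 + e, which is exactly membership
-- of s in the closed alcove: for i < j, 0 ≤ s_j - s_i ≤ s_1 + e - s_1 = e.

open import Defs
open import Data.Nat using (ℕ; _≥_)
import Data.Nat as ℕ
import Data.Nat.Properties as ℕP
open import Data.Integer using (ℤ; +_; _+_; _-_; _≤_; _<_; +≤+; +<+)
import Data.Integer.Properties as ℤP
open import Data.Integer.Tactic.RingSolver using (solve-∀)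
open import Data.List using ([]; _∷_; length)
open import Data.Fin using (Fin; zero; suc; toℕ; inject₁; fromℕ)
import Data.Fin.Properties as FinP
open import Data.Product using (_,_; proj₁; proj₂)
open import Relation.Binary using (tri<; tri≈; tri>)
open import Relation.Binary.PropositionalEquality using (_≡_; refl; sym; trans; cong; subst; subst₂; module ≡-Reasoning)
open import Data.Empty using (⊥-elim)

part-antitone : ∀ {xs} → Nonincreasing xs → ∀ {m n} → m ℕ.≤ n → part xs n ℕ.≤ part xs m
part-antitone []                                _         = ℕ.z≤n
part-antitone [-]         {ℕ.zero}  {ℕ.zero}    _         = ℕP.≤-refl
part-antitone [-]         {ℕ.zero}  {ℕ.suc n}   _         = ℕ.z≤n
part-antitone [-]         {ℕ.suc m} {ℕ.suc n}   _         = ℕ.z≤n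
part-antitone (b≤a ∷ ni)  {ℕ.zero}  {ℕ.zero}    _         = ℕP.≤-refl
part-antitone (b≤a ∷ ni)  {ℕ.zero}  {ℕ.suc n}   _         = ℕP.≤-trans (part-antitone ni {0} {n} ℕ.z≤n) b≤a
part-antitone (b≤a ∷ ni)  {ℕ.suc m} {ℕ.suc n}   (ℕ.s≤s p) = part-antitone ni p

part-beyond : ∀ xs n → length xs ℕ.≤ n → part xs n ≡ 0
part-beyond []       n         _         = refl
part-beyond (x ∷ xs) (ℕ.suc n) (ℕ.s≤s p) = part-beyond xs n p

bead : ℤ → Partition → ℕ → ℤ
bead s p j = (+ part (Partition.parts p) j) - (+ ℕ.suc j) + s

bead-decreasing : ∀ s p {m n} → m ℕ.< n → bead s p n < bead s p m
bead-decreasing s p m<n = ℤP.+-monoˡ-< s (ℤP.+-mono-≤-<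
  (+≤+ (part-antitone (Partition.nonincr p) (ℕP.<⇒≤ m<n)))
  (ℤP.neg-mono-< (+<+ (ℕ.s≤s m<n))))

bead-index-increasing : ∀ s p {m n} → bead s p n < bead s p m → m ℕ.< n
bead-index-increasing s p {m} {n} b<b with ℕP.<-cmp m n
... | tri< m<n _ _ = m<n
... | tri≈ _ refl _ = ⊥-elim (ℤP.<-irrefl refl b<b)
... | tri> _ _ n<m = ⊥-elim (ℤP.<-asym b<b (bead-decreasing s p n<m))

bead-beyond : ∀ s p j → length (Partition.parts p) ℕ.≤ j → bead s p j ≡ s - + ℕ.suc j
bead-beyond s p j len≤j = trans
  (cong (λ a → + a - + ℕ.suc j + s) (part-beyond (Partition.parts p) j len≤j))
  (shuffle s (+ ℕ.suc j))
  where
  shuffle : ∀ (x y : ℤ) → + 0 - y + x ≡ x - y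
  shuffle = solve-∀

strictlyIncreasing⇒inflationary : (k : ℕ → ℕ) → (∀ j → k j ℕ.< k (ℕ.suc j)) → ∀ j → j ℕ.≤ k j
strictlyIncreasing⇒inflationary k inc ℕ.zero    = ℕ.z≤n
strictlyIncreasing⇒inflationary k inc (ℕ.suc j) =
  ℕP.≤-<-trans (strictlyIncreasing⇒inflationary k inc j) (inc j)

shifted-equal⇒≤ : ∀ s t {m n} → s - + m ≡ t - + n → m ℕ.≤ n → s ≤ t
shifted-equal⇒≤ s t {m} {n} eq m≤n = begin
  s             ≡⟨ undo s (+ m) ⟩
  s - + m + + m ≡⟨ cong (_+ + m) eq ⟩
  t - + n + + m ≤⟨ ℤP.+-monoʳ-≤ (t - + n) (+≤+ m≤n) ⟩
  t - + n + + n ≡⟨ sym (undo t (+ n)) ⟩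
  t             ∎
  where
  open ℤP.≤-Reasoning
  undo : ∀ (x y : ℤ) → x ≡ x - y + y
  undo = solve-∀

abacus-⊆⇒charge-≤ : ∀ s t p q → s , p ⊆L t , q → s ≤ t
abacus-⊆⇒charge-≤ s t p q incl =
  shifted-equal⇒≤ s t matchFar (ℕ.s≤s (inflationary far))
  where
  -- the index in L_t(μ) of the image of the j-th bead of L_s(λ)
  match : ℕ → ℕ
  match j = proj₁ (incl (bead s p j) (j , refl))

  match-bead : ∀ j → bead s p j ≡ bead t q (match j)
  match-bead j = proj₂ (incl (bead s p j) (j , refl))

  match-increasing : ∀ j → match j ℕ.< match (ℕ.suc j)
  match-increasing j = bead-index-increasing t q
    (subst₂ _<_ (match-bead (ℕ.suc j)) (match-bead j) (bead-decreasing s p (ℕP.n<1+n j)))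

  inflationary : ∀ j → j ℕ.≤ match j
  inflationary = strictlyIncreasing⇒inflationary match match-increasing

  -- an index beyond the parts of both partitions
  lenP lenQ far : ℕ
  lenP = length (Partition.parts p)
  lenQ = length (Partition.parts q)
  far  = lenP ℕ.+ lenQ

  matchFar : s - + ℕ.suc far ≡ t - + ℕ.suc (match far)
  matchFar = begin
    s - + ℕ.suc far          ≡⟨ sym (bead-beyond s p far (ℕP.m≤m+n lenP lenQ)) ⟩
    bead s p far             ≡⟨ match-bead far ⟩
    bead t q (match far)     ≡⟨ bead-beyond t q (match far)
                                  (ℕP.≤-trans (ℕP.m≤n+m lenQ lenP) (inflationary far)) ⟩
    t - + ℕ.suc (match far)  ∎
    where open ≡-Reasoning

stepwise⇒monotone : ∀ n (s : Fin (ℕ.suc n) → ℤ) → (∀ (i : Fin n) → s (inject₁ i) ≤ s (suc i)) →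
                    ∀ (i j : Fin (ℕ.suc n)) → toℕ i ℕ.≤ toℕ j → s i ≤ s j
stepwise⇒monotone n         s step zero    zero    _ = ℤP.≤-refl
stepwise⇒monotone (ℕ.suc n) s step zero    (suc j) _ =
  ℤP.≤-trans (step zero) (stepwise⇒monotone n (λ x → s (suc x)) (λ i → step (suc i)) zero j ℕ.z≤n)
stepwise⇒monotone (ℕ.suc n) s step (suc i) (suc j) (ℕ.s≤s i≤j) =
  stepwise⇒monotone n (λ x → s (suc x)) (λ i → step (suc i)) i j i≤j

difference-bound : ∀ (e : ℕ) {a b c : ℤ} → c ≤ a + + e → a ≤ b → c - b ≤ + e
difference-bound e {a} h1 h2 =
  subst (_ ≤_) (cancel a (+ e)) (ℤP.+-mono-≤ h1 (ℤP.neg-mono-≤ h2))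
  where
  cancel : ∀ (x y : ℤ) → x + y - x ≡ y
  cancel = solve-∀

mainTheorem1 : (e l : ℕ) → e ≥ 2 → l ≥ 1 → (s : Fin l → ℤ) → (λs : Fin l → Partition) →
    ReducedCore e l s λs → InClosedAlcove e l s
mainTheorem1 e (ℕ.suc ℕ.zero) _ _ s λs _ zero zero ()
mainTheorem1 e (ℕ.suc (ℕ.suc l)) _ _ s λs (steps , wrap) i j i<j =
  ℤP.i≤j⇒0≤j-i (monotone i j (ℕP.<⇒≤ i<j)) ,
  difference-bound e (ℤP.≤-trans (monotone j last (FinP.≤fromℕ j)) last≤first+e) (monotone zero i ℕ.z≤n)
  where
  last : Fin (ℕ.suc (ℕ.suc l))
  last = fromℕ (ℕ.suc l)

  monotone : ∀ (a b : Fin (ℕ.suc (ℕ.suc l))) → toℕ a ℕ.≤ toℕ b → s a ≤ s b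
  monotone = stepwise⇒monotone (ℕ.suc l) s
    (λ a → abacus-⊆⇒charge-≤ _ _ (λs (inject₁ a)) (λs (suc a)) (steps a))

  last≤first+e : s last ≤ s zero + + e
  last≤first+e = abacus-⊆⇒charge-≤ _ _ (λs last) (λs zero) wrap
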